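{- For integers $n\geq 1$ and $r\geq 1$, \[ \sum_{k=0}^n {n \brace k}_r(-1)^{k+r-1}D_{k+r-1}=B_{n-1,r}. \]
   Context: For $r\geq 0$, ${n \brace k}_r$ denotes the $r$-Stirling number of the second kind: the number of partitions of $\{1,\dots,n+r\}$ into $k+r$ non-empty blocks such that $1,\dots,r$ lie in distinct blocks. $D_n$ is the $n$-th derangement number. The $r$-Bell numbers are defined by $\sum_{n\geq 0}B_{n,r}\frac{t^n}{n!}=e^{e^t-1+rt}$; equivalently for $r\geq0$, $B_{n,r}=\sum_{k=0}^n{n\brace k}_r$. -}

module Defs where

open import Data.Nat using (ℕ; zero; suc; _+_; _*_)
open import Data.Integer using (ℤ; +_) renaming (_+_ to _+ℤ_; _*_ to _*ℤ_)
open import Data.Integer using (-_)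

rStirling₂ : ℕ → ℕ → ℕ → ℕ
rStirling₂ r zero    zero    = 1
rStirling₂ r zero    (suc k) = 0
rStirling₂ r (suc n) zero    = r * rStirling₂ r n zero
rStirling₂ r (suc n) (suc k) = rStirling₂ r n k + (suc k + r) * rStirling₂ r n (suc k)

derangement : ℕ → ℕ
derangement zero          = 1
derangement (suc zero)    = 0
derangement (suc (suc n)) = suc n * (derangement (suc n) + derangement n)

sumTo : ℕ → (ℕ → ℤ) → ℤ
sumTo zero    f = f 0
sumTo (suc n) f = sumTo n f +ℤ f (suc n)

sumToℕ : ℕ → (ℕ → ℕ) → ℕ
sumToℕ zero    f = f 0
sumToℕ (suc n) f = sumToℕ n f + f (suc n)

signPow : ℕ → ℤ
signPow zero    = + 1
signPow (suc m) = - signPow m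

rBell : ℕ → ℕ → ℕ
rBell n r = sumToℕ n (λ k → rStirling₂ r n k)

{-# OPTIONS --safe #-}
-- Unfolding the triangular recurrence once turns a sum  Σ_k {n+1 brace k}_r g(k)  into
-- Σ_k {n brace k}_r (g(k+1) + (k+r) g(k)).  For g(k) = (-1)^(k+r-1) D_(k+r-1) the new weight
-- is (-1)^m (D_m - m D_(m-1)) with m = k + r, which is 1 by the derangement recurrence
-- D_m = m D_(m-1) + (-1)^m; what is left is Σ_k {n brace k}_r = B_(n,r).
module Submission where

open import Defs
open import Data.Nat using (ℕ; _+_; _∸_; _≥_)
open import Data.Integer using (ℤ; +_; _*_)
open import Relation.Binary.PropositionalEquality using (_≡_)

open import Function using (_∘_)
open import Data.Nat using (zero; suc; _<_; s≤s) renaming (_*_ to _*ℕ_)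
open import Data.Nat.Properties using (n<1+n; m<n⇒m<1+n; *-zeroʳ)
open import Data.Integer using (-_; _-_) renaming (_+_ to _+ℤ_)
open import Data.Integer.Properties
  using (+-assoc; +-identityʳ; +-commutativeSemigroup; *-identityʳ; *-comm; *-assoc;
         *-distribˡ-+; *-distribʳ-+; neg-involutive; pos-+; pos-*)
open import Data.Integer.Tactic.RingSolver using (solve-∀)
open import Algebra.Properties.CommutativeSemigroup +-commutativeSemigroup
  using (interchange; x∙yz≈y∙xz)
open import Relation.Binary.PropositionalEquality
  using (refl; sym; trans; cong; cong₂; module ≡-Reasoning)
open ≡-Reasoning

sumTo-cong : ∀ n {f g : ℕ → ℤ} → (∀ k → f k ≡ g k) → sumTo n f ≡ sumTo n g
sumTo-cong zero    f≗g = f≗g 0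
sumTo-cong (suc n) f≗g = cong₂ _+ℤ_ (sumTo-cong n f≗g) (f≗g (suc n))

sumTo-+ : ∀ n (f g : ℕ → ℤ) → sumTo n (λ k → f k +ℤ g k) ≡ sumTo n f +ℤ sumTo n g
sumTo-+ zero    f g = refl
sumTo-+ (suc n) f g = trans (cong (_+ℤ (f (suc n) +ℤ g (suc n))) (sumTo-+ n f g))
                            (interchange (sumTo n f) (sumTo n g) (f (suc n)) (g (suc n)))

sumTo-suc : ∀ n (f : ℕ → ℤ) → sumTo (suc n) f ≡ f 0 +ℤ sumTo n (f ∘ suc)
sumTo-suc zero    f = refl
sumTo-suc (suc n) f = begin
  sumTo (suc n) f +ℤ f (suc (suc n))               ≡⟨ cong (_+ℤ f (suc (suc n))) (sumTo-suc n f) ⟩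
  (f 0 +ℤ sumTo n (f ∘ suc)) +ℤ f (suc (suc n))    ≡⟨ +-assoc (f 0) _ _ ⟩
  f 0 +ℤ sumTo (suc n) (f ∘ suc)                   ∎

pos-sumToℕ : ∀ n (f : ℕ → ℕ) → + sumToℕ n f ≡ sumTo n (+_ ∘ f)
pos-sumToℕ zero    f = refl
pos-sumToℕ (suc n) f = trans (pos-+ (sumToℕ n f) (f (suc n)))
                             (cong (_+ℤ + f (suc n)) (pos-sumToℕ n f))

rStirling₂-above-diagonal : ∀ r {n k} → n < k → rStirling₂ r n k ≡ 0
rStirling₂-above-diagonal r {zero}  {suc k} _       = refl
rStirling₂-above-diagonal r {suc n} {suc k} (s≤s n<k) = begin
  rStirling₂ r n k + (suc k + r) *ℕ rStirling₂ r n (suc k)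
    ≡⟨ cong₂ (λ a b → a + (suc k + r) *ℕ b)
             (rStirling₂-above-diagonal r n<k)
             (rStirling₂-above-diagonal r (m<n⇒m<1+n n<k)) ⟩
  (suc k + r) *ℕ 0
    ≡⟨ *-zeroʳ (suc k + r) ⟩
  0 ∎

rStirlingTransform : ℕ → ℕ → (ℕ → ℤ) → ℤ
rStirlingTransform r n g = sumTo n (λ k → + rStirling₂ r n k * g k)

rStirlingTransform-cong : ∀ r n {g h : ℕ → ℤ} → (∀ k → g k ≡ h k) →
  rStirlingTransform r n g ≡ rStirlingTransform r n h
rStirlingTransform-cong r n g≗h = sumTo-cong n (λ k → cong (+ rStirling₂ r n k *_) (g≗h k))

rStirlingTransform-suc : ∀ r n (g : ℕ → ℤ) →
  rStirlingTransform r (suc n) g ≡ rStirlingTransform r n (λ k → g (suc k) +ℤ + (k + r) * g k)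
rStirlingTransform-suc r n g = begin
  sumTo (suc n) summand
    ≡⟨ sumTo-suc n summand ⟩
  joinBlock 0 +ℤ sumTo n (summand ∘ suc)
    ≡⟨ cong (joinBlock 0 +ℤ_) (trans (sumTo-cong n summand-suc) (sumTo-+ n newBlock (joinBlock ∘ suc))) ⟩
  joinBlock 0 +ℤ (sumTo n newBlock +ℤ sumTo n (joinBlock ∘ suc))
    ≡⟨ x∙yz≈y∙xz (joinBlock 0) (sumTo n newBlock) _ ⟩
  sumTo n newBlock +ℤ (joinBlock 0 +ℤ sumTo n (joinBlock ∘ suc))
    ≡⟨ cong (sumTo n newBlock +ℤ_) (sym (sumTo-suc n joinBlock)) ⟩
  sumTo n newBlock +ℤ sumTo (suc n) joinBlock
    ≡⟨ cong (sumTo n newBlock +ℤ_) joinBlock-top ⟩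
  sumTo n newBlock +ℤ sumTo n joinBlock
    ≡⟨ sym (sumTo-+ n newBlock joinBlock) ⟩
  sumTo n (λ k → newBlock k +ℤ joinBlock k)
    ≡⟨ sumTo-cong n (λ k → trans (cong (newBlock k +ℤ_) (joinBlock-factor k))
                                 (sym (*-distribˡ-+ (S k) (g (suc k)) _))) ⟩
  rStirlingTransform r n (λ k → g (suc k) +ℤ + (k + r) * g k) ∎
  where
  S : ℕ → ℤ
  S k = + rStirling₂ r n k
  summand newBlock joinBlock : ℕ → ℤ
  summand  k = + rStirling₂ r (suc n) k * g k
  newBlock k = S k * g (suc k)
  joinBlock k = + ((k + r) *ℕ rStirling₂ r n k) * g k

  summand-suc : ∀ k → summand (suc k) ≡ newBlock k +ℤ joinBlock (suc k)
  summand-suc k = trans (cong (_* g (suc k)) (pos-+ (rStirling₂ r n k) _))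
                    (*-distribʳ-+ (g (suc k)) (S k) (+ ((suc k + r) *ℕ rStirling₂ r n (suc k))))

  joinBlock-top : sumTo (suc n) joinBlock ≡ sumTo n joinBlock
  joinBlock-top = trans (cong (sumTo n joinBlock +ℤ_) joinBlock-vanishes) (+-identityʳ (sumTo n joinBlock))
    where
    joinBlock-vanishes : joinBlock (suc n) ≡ + 0
    joinBlock-vanishes = cong (λ s → + s * g (suc n))
      (trans (cong ((suc n + r) *ℕ_) (rStirling₂-above-diagonal r (n<1+n n))) (*-zeroʳ (suc n + r)))

  joinBlock-factor : ∀ k → joinBlock k ≡ S k * (+ (k + r) * g k)
  joinBlock-factor k = begin
    + ((k + r) *ℕ rStirling₂ r n k) * g k ≡⟨ cong (_* g k) (trans (pos-* (k + r) _) (*-comm (+ (k + r)) (S k))) ⟩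
    S k * + (k + r) * g k                  ≡⟨ *-assoc (S k) _ _ ⟩
    S k * (+ (k + r) * g k)                ∎

rBell-rStirlingTransform : ∀ n r → + rBell n r ≡ rStirlingTransform r n (λ _ → + 1)
rBell-rStirlingTransform n r =
  trans (pos-sumToℕ n (rStirling₂ r n)) (sumTo-cong n (λ k → sym (*-identityʳ (+ rStirling₂ r n k))))

signedDerangement : ℕ → ℤ
signedDerangement m = signPow m * + derangement m

signedDerangement-suc-suc : ∀ s → signedDerangement (suc (suc s)) ≡
  + suc s * (signedDerangement s - signedDerangement (suc s))
signedDerangement-suc-suc s = begin
  - - σ * + (suc s *ℕ (derangement (suc s) + derangement s))
    ≡⟨ cong₂ _*_ (neg-involutive σ)
                 (trans (pos-* (suc s) _) (cong (+ suc s *_) (pos-+ (derangement (suc s)) _))) ⟩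
  σ * (+ suc s * (+ derangement (suc s) +ℤ + derangement s))
    ≡⟨ factor σ (+ suc s) (+ derangement (suc s)) (+ derangement s) ⟩
  + suc s * (σ * + derangement s - - σ * + derangement (suc s)) ∎
  where
  σ : ℤ
  σ = signPow s
  factor : ∀ σ t a b → σ * (t * (a +ℤ b)) ≡ t * (σ * b - - σ * a)
  factor = solve-∀

signedDerangement-recurrence : ∀ m → signedDerangement m +ℤ + m * signedDerangement (m ∸ 1) ≡ + 1
signedDerangement-recurrence zero          = refl
signedDerangement-recurrence (suc zero)    = refl
signedDerangement-recurrence (suc (suc s)) = begin
  signedDerangement (suc (suc s)) +ℤ + suc (suc s) * signedDerangement (suc s)
    ≡⟨ cong (_+ℤ + suc (suc s) * signedDerangement (suc s)) (signedDerangement-suc-suc s) ⟩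
  + suc s * (signedDerangement s - signedDerangement (suc s)) +ℤ (+ 1 +ℤ + suc s) * signedDerangement (suc s)
    ≡⟨ collect (+ suc s) (signedDerangement s) (signedDerangement (suc s)) ⟩
  signedDerangement (suc s) +ℤ + suc s * signedDerangement s
    ≡⟨ signedDerangement-recurrence (suc s) ⟩
  + 1 ∎
  where
  collect : ∀ t a b → t * (a - b) +ℤ (+ 1 +ℤ t) * b ≡ b +ℤ t * a
  collect = solve-∀

corollary1 : (n r : ℕ) → n ≥ 1 → r ≥ 1 →
    sumTo n (λ k → (+ rStirling₂ r n k) * (signPow (k + r ∸ 1) * + derangement (k + r ∸ 1)))
      ≡ + rBell (n ∸ 1) r
corollary1 zero    _ () _
corollary1 (suc n) r _  _ = begin
  rStirlingTransform r (suc n) (λ k → signedDerangement (k + r ∸ 1))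
    ≡⟨ rStirlingTransform-suc r n (λ k → signedDerangement (k + r ∸ 1)) ⟩
  rStirlingTransform r n (λ k → signedDerangement (k + r) +ℤ + (k + r) * signedDerangement (k + r ∸ 1))
    ≡⟨ rStirlingTransform-cong r n (λ k → signedDerangement-recurrence (k + r)) ⟩
  rStirlingTransform r n (λ _ → + 1)
    ≡⟨ sym (rBell-rStirlingTransform n r) ⟩
  + rBell n r ∎
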